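{- Fix a Motzkin path $P$ of length $n$. Then the map $Q\mapsto\overline Q$ is a bijection from the set of Motzkin paths $Q$ with $Q\geq_C P$ to the set of Dyck prefixes $A$ of length $n$ with $A\geq\overline P$ and with the same numbers of $u$'s and $d$'s as $\overline P$.
   Context: A Motzkin path of length $n$ is a word $P_1\cdots P_n$ in $\{U,D,E\}$ with equally many $U$'s and $D$'s such that every prefix has at least as many $U$'s as $D$'s. The class of $P$ is its subsequence of $U$'s and $E$'s. $P\leq_S Q$ means that for every $m$ the height ($\#U-\#D$) of $P_1\cdots P_m$ is at most that of $Q_1\cdots Q_m$; $P\leq_C Q$ (equivalently $Q\ge_C P$) means $P,Q$ have the same class and $P\leq_S Q$. A Dyck prefix of length $n$ is a word $A_1\cdots A_n$ in $\{u,d\}$ such that every prefix has at least as many $u$'s as $d$'s; for Dyck prefixes of equal length, $A\geq A'$ if every prefix $A_1\cdots A_i$ has at least as many $u$'s as $A'_1\cdots A'_i$. The support $\overline P$ of $P$ is the Dyck prefix with $\overline P_i=u$ if $P_i\in\{U,E\}$ and $\overline P_i=d$ if $P_i=D$. -}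

module Defs where

open import Data.Nat using (ℕ; zero; suc)
open import Data.Integer using (ℤ; _+_; -_; _≤_; 0ℤ; 1ℤ)
open import Data.Fin using (Fin; toℕ)
open import Data.Vec using (Vec; []; _∷_)
open import Data.List using (List; []; _∷_)
open import Data.Product using (_×_)
open import Relation.Binary.PropositionalEquality using (_≡_)

data Step : Set where
  U D E : Step

data Letter : Set where
  u d : Letter

stepH : Step → ℤ
stepH U = 1ℤ
stepH D = - 1ℤ
stepH E = 0ℤ

height : ∀ {n} → ℕ → Vec Step n → ℤ
height zero    _       = 0ℤ
height (suc m) []      = 0ℤ
height (suc m) (s ∷ w) = stepH s + height m w

nu : ∀ {n} → ℕ → Vec Letter n → ℕ
nu zero    _       = 0
nu (suc m) []      = 0
nu (suc m) (u ∷ w) = suc (nu m w)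
nu (suc m) (d ∷ w) = nu m w

nd : ∀ {n} → ℕ → Vec Letter n → ℕ
nd zero    _       = 0
nd (suc m) []      = 0
nd (suc m) (u ∷ w) = nd m w
nd (suc m) (d ∷ w) = suc (nd m w)

IsMotzkin : ∀ {n} → Vec Step n → Set
IsMotzkin {n} P = (∀ (m : Fin (suc n)) → 0ℤ ≤ height (toℕ m) P) × height n P ≡ 0ℤ

IsDyckPrefix : ∀ {n} → Vec Letter n → Set
IsDyckPrefix {n} A = ∀ (m : Fin (suc n)) → nd (toℕ m) A Data.Nat.≤ nu (toℕ m) A

class : ∀ {n} → Vec Step n → List Step
class []      = []
class (U ∷ w) = U ∷ class w
class (E ∷ w) = E ∷ class w
class (D ∷ w) = class w

_≤S_ : ∀ {n} → Vec Step n → Vec Step n → Set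
_≤S_ {n} P Q = ∀ (m : Fin (suc n)) → height (toℕ m) P ≤ height (toℕ m) Q

_≤C_ : ∀ {n} → Vec Step n → Vec Step n → Set
P ≤C Q = class P ≡ class Q × P ≤S Q

_≥D_ : ∀ {n} → Vec Letter n → Vec Letter n → Set
_≥D_ {n} A A' = ∀ (m : Fin (suc n)) → nu (toℕ m) A' Data.Nat.≤ nu (toℕ m) A

supp : Step → Letter
supp U = u
supp E = u
supp D = d

support : ∀ {n} → Vec Step n → Vec Letter n
support []      = []
support (s ∷ w) = supp s ∷ support w

-- Write k = nu m (support Q) for the number of non-D steps among the first m
-- steps of Q. These are the first k letters of the class of Q, so the first m
-- steps contain exactly U_k(class Q) up-steps, where U_k counts the U's among
-- the first k letters of a word, and hence
--   height m Q + m = U_k(class Q) + k.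
-- The right-hand side is strictly increasing in k, so for paths of the same
-- class comparing heights is the same as comparing the number of u's of their
-- supports. This turns Q ≥C P into support Q ≥D support P. Conversely a path is
-- recovered from its class and its support by writing the class into the
-- u-positions and D into the d-positions.
module Submission where

open import Defs
open import Data.Nat using (ℕ)
open import Data.Vec using (Vec)
open import Data.Product using (_×_; Σ; _,_)
open import Relation.Binary.PropositionalEquality using (_≡_)

open import Data.Nat as ℕ using (zero; suc; z≤n; s≤s)
import Data.Nat.Properties as ℕ
open import Data.Integer as ℤ using (ℤ; +_; 0ℤ; 1ℤ; -_)
import Data.Integer.Properties as ℤ
open import Data.Integer.Solver using (module +-*-Solver)
open import Data.Vec using ([]; _∷_)
open import Data.List using (List; []; _∷_; length; map)
open import Data.Fin using (Fin; toℕ; fromℕ)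
open import Data.Fin.Properties using (toℕ≤pred[n]; toℕ-fromℕ)
open import Data.Sum using (inj₁; inj₂)
open import Function using (_∘′_; _⇔_; mk⇔; Equivalence)
open import Relation.Nullary using (contradiction)
open import Relation.Binary.PropositionalEquality
  using (refl; sym; trans; cong; cong₂; subst; subst₂; module ≡-Reasoning)

private
  variable
    n : ℕ

countU : ℕ → List Step → ℕ
countU zero    _       = 0
countU (suc k) []      = 0
countU (suc k) (U ∷ c) = suc (countU k c)
countU (suc k) (E ∷ c) = countU k c
countU (suc k) (D ∷ c) = countU k c

countU≤ : ∀ k c → countU k c ℕ.≤ k
countU≤ zero    c       = z≤n
countU≤ (suc k) []      = z≤n
countU≤ (suc k) (U ∷ c) = s≤s (countU≤ k c)
countU≤ (suc k) (E ∷ c) = ℕ.m≤n⇒m≤1+n (countU≤ k c)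
countU≤ (suc k) (D ∷ c) = ℕ.m≤n⇒m≤1+n (countU≤ k c)

countU-mono-≤ : ∀ c {k k′} → k ℕ.≤ k′ → countU k c ℕ.≤ countU k′ c
countU-mono-≤ c       z≤n     = z≤n
countU-mono-≤ []      (s≤s p) = z≤n
countU-mono-≤ (U ∷ c) (s≤s p) = s≤s (countU-mono-≤ c p)
countU-mono-≤ (E ∷ c) (s≤s p) = countU-mono-≤ c p
countU-mono-≤ (D ∷ c) (s≤s p) = countU-mono-≤ c p

weight : List Step → ℕ → ℕ
weight c k = countU k c ℕ.+ k

weight-mono-≤ : ∀ c {k k′} → k ℕ.≤ k′ → weight c k ℕ.≤ weight c k′
weight-mono-≤ c p = ℕ.+-mono-≤ (countU-mono-≤ c p) p

weight-cancel-≤ : ∀ c {k k′} → weight c k ℕ.≤ weight c k′ → k ℕ.≤ k′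
weight-cancel-≤ c {k} {k′} w≤w with ℕ.≤-<-connex k k′
... | inj₁ k≤k′ = k≤k′
... | inj₂ k′<k =
  contradiction w≤w (ℕ.<⇒≱ (ℕ.+-mono-≤-< (countU-mono-≤ c (ℕ.<⇒≤ k′<k)) k′<k))

nu+nd≡length : ∀ (A : Vec Letter n) m → m ℕ.≤ n → nu m A ℕ.+ nd m A ≡ m
nu+nd≡length A       zero    _       = refl
nu+nd≡length (u ∷ A) (suc m) (s≤s p) = cong suc (nu+nd≡length A m p)
nu+nd≡length (d ∷ A) (suc m) (s≤s p) =
  trans (ℕ.+-suc (nu m A) (nd m A)) (cong suc (nu+nd≡length A m p))

nu-≡⇒nd-≡ : ∀ (A B : Vec Letter n) → nu n A ≡ nu n B → nd n A ≡ nd n B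
nu-≡⇒nd-≡ {n} A B nu≡ = ℕ.+-cancelˡ-≡ (nu n A) _ _ (begin
  nu n A ℕ.+ nd n A ≡⟨ nu+nd≡length A n ℕ.≤-refl ⟩
  n                 ≡⟨ nu+nd≡length B n ℕ.≤-refl ⟨
  nu n B ℕ.+ nd n B ≡⟨ cong (ℕ._+ nd n B) nu≡ ⟨
  nu n A ℕ.+ nd n B ∎)
  where open ≡-Reasoning

+-regroup : ∀ (a h x : ℤ) → (a ℤ.+ h) ℤ.+ (1ℤ ℤ.+ x) ≡ (a ℤ.+ 1ℤ) ℤ.+ (h ℤ.+ x)
+-regroup = solve 3 (λ a h x → (a :+ h) :+ (con 1ℤ :+ x) := (a :+ con 1ℤ) :+ (h :+ x)) refl
  where open +-*-Solver

height+length≡weight : ∀ (Q : Vec Step n) m → m ℕ.≤ n →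
  height m Q ℤ.+ + m ≡ + weight (class Q) (nu m (support Q))
height+length≡weight Q zero _ = refl
height+length≡weight (U ∷ Q) (suc m) (s≤s p) = begin
  (1ℤ ℤ.+ height m Q) ℤ.+ + suc m       ≡⟨ +-regroup 1ℤ (height m Q) (+ m) ⟩
  + 2 ℤ.+ (height m Q ℤ.+ + m)         ≡⟨ cong (ℤ._+_ (+ 2)) (height+length≡weight Q m p) ⟩
  + suc (suc (countU k c ℕ.+ k))       ≡⟨ cong (+_ ∘′ suc) (ℕ.+-suc (countU k c) k) ⟨
  + (suc (countU k c) ℕ.+ suc k)       ∎
  where
  open ≡-Reasoning
  k : ℕ
  k = nu m (support Q)
  c : List Step
  c = class Q
height+length≡weight (E ∷ Q) (suc m) (s≤s p) = begin
  (0ℤ ℤ.+ height m Q) ℤ.+ + suc m       ≡⟨ +-regroup 0ℤ (height m Q) (+ m) ⟩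
  1ℤ ℤ.+ (height m Q ℤ.+ + m)          ≡⟨ cong (ℤ._+_ 1ℤ) (height+length≡weight Q m p) ⟩
  + suc (countU k c ℕ.+ k)             ≡⟨ cong +_ (ℕ.+-suc (countU k c) k) ⟨
  + (countU k c ℕ.+ suc k)             ∎
  where
  open ≡-Reasoning
  k : ℕ
  k = nu m (support Q)
  c : List Step
  c = class Q
height+length≡weight (D ∷ Q) (suc m) (s≤s p) = begin
  (- 1ℤ ℤ.+ height m Q) ℤ.+ + suc m     ≡⟨ +-regroup (- 1ℤ) (height m Q) (+ m) ⟩
  0ℤ ℤ.+ (height m Q ℤ.+ + m)          ≡⟨ ℤ.+-identityˡ _ ⟩
  height m Q ℤ.+ + m                   ≡⟨ height+length≡weight Q m p ⟩
  + weight (class Q) (nu m (support Q)) ∎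
  where open ≡-Reasoning

+-cancelʳ-≤ : ∀ {a b : ℤ} c → a ℤ.+ c ℤ.≤ b ℤ.+ c → a ℤ.≤ b
+-cancelʳ-≤ {a} {b} c a+c≤b+c = subst₂ ℤ._≤_ (x+c-c≡x a) (x+c-c≡x b) (ℤ.+-monoˡ-≤ (- c) a+c≤b+c)
  where
  x+c-c≡x : ∀ x → x ℤ.+ c ℤ.+ - c ≡ x
  x+c-c≡x x = trans (ℤ.+-assoc x c (- c))
            (trans (cong (ℤ._+_ x) (ℤ.+-inverseʳ c)) (ℤ.+-identityʳ x))

height-≤⇔nu-≤ : ∀ (P Q : Vec Step n) → class P ≡ class Q → ∀ m → m ℕ.≤ n →
  height m P ℤ.≤ height m Q ⇔ nu m (support P) ℕ.≤ nu m (support Q)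
height-≤⇔nu-≤ P Q cl m m≤n = mk⇔
  (λ h≤h → weight-cancel-≤ (class Q) (ℤ.drop‿+≤+
    (subst₂ ℤ._≤_ weightP weightQ (ℤ.+-monoˡ-≤ (+ m) h≤h))))
  (λ nu≤nu → +-cancelʳ-≤ (+ m)
    (subst₂ ℤ._≤_ (sym weightP) (sym weightQ) (ℤ.+≤+ (weight-mono-≤ (class Q) nu≤nu))))
  where
  weightP : height m P ℤ.+ + m ≡ + weight (class Q) (nu m (support P))
  weightP = trans (height+length≡weight P m m≤n)
                  (cong (λ c → + weight c (nu m (support P))) cl)
  weightQ : height m Q ℤ.+ + m ≡ + weight (class Q) (nu m (support Q))
  weightQ = height+length≡weight Q m m≤n

≤S⇔≥D : ∀ (P Q : Vec Step n) → class P ≡ class Q → P ≤S Q ⇔ support Q ≥D support P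
≤S⇔≥D {n} P Q cl = mk⇔
  (λ P≤Q m → Equivalence.to   (compare m) (P≤Q m))
  (λ Q≥P m → Equivalence.from (compare m) (Q≥P m))
  where
  compare : ∀ (m : Fin (suc n)) →
    height (toℕ m) P ℤ.≤ height (toℕ m) Q ⇔ nu (toℕ m) (support P) ℕ.≤ nu (toℕ m) (support Q)
  compare m = height-≤⇔nu-≤ P Q cl (toℕ m) (toℕ≤pred[n] m)

≤S-final : ∀ {P Q : Vec Step n} → P ≤S Q → height n P ℤ.≤ height n Q
≤S-final {n} {P} {Q} P≤Q = subst (λ m → height m P ℤ.≤ height m Q) (toℕ-fromℕ n) (P≤Q (fromℕ n))

nonneg⇒nd≤nu : ∀ (Q : Vec Step n) m → m ℕ.≤ n → 0ℤ ℤ.≤ height m Q →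
  nd m (support Q) ℕ.≤ nu m (support Q)
nonneg⇒nd≤nu Q m m≤n 0≤h = ℕ.≤-trans (ℕ.+-cancelˡ-≤ k _ _ k+nd≤k+Uk) (countU≤ k (class Q))
  where
  k : ℕ
  k = nu m (support Q)
  m≤weight : m ℕ.≤ weight (class Q) k
  m≤weight = ℤ.drop‿+≤+ (subst (+ m ℤ.≤_) (height+length≡weight Q m m≤n)
               (ℤ.+-monoˡ-≤ (+ m) 0≤h))
  k+nd≤k+Uk : k ℕ.+ nd m (support Q) ℕ.≤ k ℕ.+ countU k (class Q)
  k+nd≤k+Uk = subst₂ ℕ._≤_ (sym (nu+nd≡length (support Q) m m≤n))
                (ℕ.+-comm (countU k (class Q)) k) m≤weight

support-isDyckPrefix : ∀ {Q : Vec Step n} → IsMotzkin Q → IsDyckPrefix (support Q)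
support-isDyckPrefix {Q = Q} (nonneg , _) m = nonneg⇒nd≤nu Q (toℕ m) (toℕ≤pred[n] m) (nonneg m)

-- Classes contain no D; sending a stray D to U makes the support of the
-- reconstruction independent of the list.
nonD : Step → Step
nonD D = U
nonD s = s

fromClassSupport : List Step → Vec Letter n → Vec Step n
fromClassSupport c       []      = []
fromClassSupport c       (d ∷ A) = D ∷ fromClassSupport c A
fromClassSupport []      (u ∷ A) = U ∷ fromClassSupport [] A
fromClassSupport (s ∷ c) (u ∷ A) = nonD s ∷ fromClassSupport c A

fromClassSupport-class-support : ∀ (Q : Vec Step n) →
  fromClassSupport (class Q) (support Q) ≡ Q
fromClassSupport-class-support []      = refl
fromClassSupport-class-support (U ∷ Q) = cong (U ∷_) (fromClassSupport-class-support Q)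
fromClassSupport-class-support (E ∷ Q) = cong (E ∷_) (fromClassSupport-class-support Q)
fromClassSupport-class-support (D ∷ Q) = cong (D ∷_) (fromClassSupport-class-support Q)

support-fromClassSupport : ∀ c (A : Vec Letter n) → length c ≡ nu n A →
  support (fromClassSupport c A) ≡ A
support-fromClassSupport []      []      _  = refl
support-fromClassSupport c       (d ∷ A) eq = cong (d ∷_) (support-fromClassSupport c A eq)
support-fromClassSupport (U ∷ c) (u ∷ A) eq =
  cong (u ∷_) (support-fromClassSupport c A (ℕ.suc-injective eq))
support-fromClassSupport (E ∷ c) (u ∷ A) eq =
  cong (u ∷_) (support-fromClassSupport c A (ℕ.suc-injective eq))
support-fromClassSupport (D ∷ c) (u ∷ A) eq =
  cong (u ∷_) (support-fromClassSupport c A (ℕ.suc-injective eq))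

class-fromClassSupport : ∀ c (A : Vec Letter n) → length c ≡ nu n A →
  class (fromClassSupport c A) ≡ map nonD c
class-fromClassSupport []      []      _  = refl
class-fromClassSupport c       (d ∷ A) eq = class-fromClassSupport c A eq
class-fromClassSupport (U ∷ c) (u ∷ A) eq =
  cong (U ∷_) (class-fromClassSupport c A (ℕ.suc-injective eq))
class-fromClassSupport (E ∷ c) (u ∷ A) eq =
  cong (E ∷_) (class-fromClassSupport c A (ℕ.suc-injective eq))
class-fromClassSupport (D ∷ c) (u ∷ A) eq =
  cong (U ∷_) (class-fromClassSupport c A (ℕ.suc-injective eq))

map-nonD-class : ∀ (P : Vec Step n) → map nonD (class P) ≡ class P
map-nonD-class []      = refl
map-nonD-class (U ∷ P) = cong (U ∷_) (map-nonD-class P)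
map-nonD-class (E ∷ P) = cong (E ∷_) (map-nonD-class P)
map-nonD-class (D ∷ P) = map-nonD-class P

length-class : ∀ (P : Vec Step n) → length (class P) ≡ nu n (support P)
length-class []      = refl
length-class (U ∷ P) = cong suc (length-class P)
length-class (E ∷ P) = cong suc (length-class P)
length-class (D ∷ P) = length-class P

support-mapsTo : ∀ (P Q : Vec Step n) → IsMotzkin P → IsMotzkin Q → P ≤C Q →
  IsDyckPrefix (support Q) × support Q ≥D support P
  × nu n (support Q) ≡ nu n (support P) × nd n (support Q) ≡ nd n (support P)
support-mapsTo {n} P Q (_ , P0) MQ@(_ , Q0) (cl , P≤Q) =
  support-isDyckPrefix MQ , Equivalence.to (≤S⇔≥D P Q cl) P≤Q , nu≡ , nu-≡⇒nd-≡ (support Q) (support P) nu≡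
  where
  nu≡ : nu n (support Q) ≡ nu n (support P)
  nu≡ = ℕ.≤-antisym
    (Equivalence.to (height-≤⇔nu-≤ Q P (sym cl) n ℕ.≤-refl) (ℤ.≤-reflexive (trans Q0 (sym P0))))
    (Equivalence.to (height-≤⇔nu-≤ P Q cl n ℕ.≤-refl) (ℤ.≤-reflexive (trans P0 (sym Q0))))

support-injective : ∀ (P Q Q′ : Vec Step n) → P ≤C Q → P ≤C Q′ →
  support Q ≡ support Q′ → Q ≡ Q′
support-injective P Q Q′ (cl , _) (cl′ , _) supp≡ = begin
  Q                                           ≡⟨ fromClassSupport-class-support Q ⟨
  fromClassSupport (class Q) (support Q)      ≡⟨ cong₂ fromClassSupport (trans (sym cl) cl′) supp≡ ⟩
  fromClassSupport (class Q′) (support Q′)    ≡⟨ fromClassSupport-class-support Q′ ⟩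
  Q′                                          ∎
  where open ≡-Reasoning

support-surjective : ∀ (P : Vec Step n) → IsMotzkin P → (A : Vec Letter n) →
  A ≥D support P → nu n A ≡ nu n (support P) →
  Σ (Vec Step n) (λ Q → IsMotzkin Q × P ≤C Q × support Q ≡ A)
support-surjective {n} P (nonneg , P0) A A≥P nu≡ =
  Q , ((λ m → ℤ.≤-trans (nonneg m) (P≤Q m)) , Q0) , (sym classQ , P≤Q) , supportQ
  where
  Q = fromClassSupport (class P) A
  lengths : length (class P) ≡ nu n A
  lengths = trans (length-class P) (sym nu≡)
  supportQ : support Q ≡ A
  supportQ = support-fromClassSupport (class P) A lengths
  classQ : class Q ≡ class P
  classQ = trans (class-fromClassSupport (class P) A lengths) (map-nonD-class P)
  P≤Q : P ≤S Q
  P≤Q = Equivalence.from (≤S⇔≥D P Q (sym classQ)) (subst (_≥D support P) (sym supportQ) A≥P)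
  Q0 : height n Q ≡ 0ℤ
  Q0 = ℤ.≤-antisym
    (subst (height n Q ℤ.≤_) P0 (Equivalence.from (height-≤⇔nu-≤ Q P classQ n ℕ.≤-refl)
      (ℕ.≤-reflexive (trans (cong (nu n) supportQ) nu≡))))
    (subst (ℤ._≤ height n Q) P0 (≤S-final P≤Q))

lemma4p6 : (n : ℕ) (P : Vec Step n) → IsMotzkin P →
    ((Q : Vec Step n) → IsMotzkin Q → P ≤C Q →
    IsDyckPrefix (support Q) × support Q ≥D support P
    × nu n (support Q) ≡ nu n (support P) × nd n (support Q) ≡ nd n (support P))
    × ((Q Q' : Vec Step n) → IsMotzkin Q → P ≤C Q → IsMotzkin Q' → P ≤C Q' →
    support Q ≡ support Q' → Q ≡ Q')
    × ((A : Vec Letter n) → IsDyckPrefix A → A ≥D support P →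
    nu n A ≡ nu n (support P) → nd n A ≡ nd n (support P) →
    Σ (Vec Step n) (λ Q → IsMotzkin Q × P ≤C Q × support Q ≡ A))
-- The Dyck-prefix and d-count hypotheses on A are implied by the remaining ones.
lemma4p6 n P MP =
  (λ Q MQ P≤Q → support-mapsTo P Q MP MQ P≤Q) ,
  (λ Q Q′ _ P≤Q _ P≤Q′ → support-injective P Q Q′ P≤Q P≤Q′) ,
  (λ A _ A≥P nu≡ _ → support-surjective P MP A A≥P nu≡)
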